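{- Let $C=\langle c_1,\ldots,c_n\rangle$ be a sequence of nonempty binary strings. Let $\alpha,\gamma\in\mathbf{H}$ be incomparable with respect to the subtree relation, assume $\alpha$ is incomparable with every $\mathsf{g}_i$ ($i\ge1$) with respect to $\sqsubseteq$, and assume $\gamma$ is not a subtree of $\mu_i$ for all $i\in\{1,\ldots,n\}$. Let $W\in\mathbf{H}$. Then $W\in\mathbb{P}_2(C,\alpha,\gamma)$ if and only if (1) there exists $X\in\tau_\gamma(\{\mu_1,\ldots,\mu_n\}^+)$ such that $\langle\alpha,X\rangle\sqsubseteq W$, and (2) there exists $T\in\mathbb{P}(C,\alpha,\gamma)$ such that $W=\langle V,\Gamma^\alpha_n(T)\rangle$ where $$V=W\Big[\langle\alpha,X\rangle\mapsto\alpha,\ \langle\mu_1,0\rangle\mapsto\mu_1,\ \ldots,\ \langle\mu_n,0\rangle\mapsto\mu_n\Big],$$ with $X$ as in (1).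
   Context: $\mathbf{H}$ is the set of finite full binary trees (variable-free terms over $\perp$ and binary $\langle\cdot,\cdot\rangle$); $\sqsubseteq$ is the subtree relation; $t[r\mapsto s]$ replaces each occurrence of $r$ in $t$ by $s$, and $t[r_1\mapsto s_1,\ldots,r_k\mapsto s_k]$ means $t[r_1\mapsto s_1]\cdots[r_k\mapsto s_k]$. Left-nested tuples: $\langle x\rangle=x$, $\langle x_1,\ldots,x_{m+1}\rangle=\langle\langle x_1,\ldots,x_m\rangle,x_{m+1}\rangle$; $\perp^1=\perp$, $\perp^{k+1}=\langle\perp^k,\perp\rangle$. For $i\ge1$ let $\mathsf{g}_i=\langle\perp^{3+i},\perp^{3+i}\rangle$. The letters of the alphabet $\{0,1,\mu_1,\ldots,\mu_{2n}\}$ ($\mu_i$ distinct fresh letters) are assigned injectively to trees $\mathsf{g}_i$, and each letter is identified with its tree. For a finite alphabet $A$ and a tree $\alpha$, $\tau_\alpha:A^*\to\mathbf{H}$ is defined by $\tau_\alpha(\varepsilon)=\alpha$, $\tau_\alpha(a)=\langle\alpha,a\rangle$ for a letter $a$, and $\tau_\alpha(w_0w_1)=\tau_\alpha(w_0)[\alpha\mapsto\tau_\alpha(w_1)]$ when $w_0$ is a single letter; write $\tfrac{w}{\alpha}$ for $\tau_\alpha(w)$ (so e.g. $\tfrac{0}{\mu_i}=\langle\mu_i,0\rangle$). For $c_i=w_id$ with $d\in\{0,1\}$ its last letter set $\tfrac{c_{i_1}\cdots c_{i_m}}{C,\alpha}=\tfrac{w_{i_1}\mu_{i_1}\cdots w_{i_m}\mu_{i_m}}{\alpha}$.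 $\mathbb{P}(C,\alpha,\gamma)$ is the smallest subset of $\mathbf{H}$ containing $\langle\gamma,\tfrac{c_i}{C,\alpha}\rangle$ for all $i$ and such that if $T=\big\langle R,\tfrac{c_{i_1}\cdots c_{i_m}}{C,\alpha}\big\rangle\in\mathbb{P}(C,\alpha,\gamma)$ then $\big\langle T,\tfrac{c_{i_1}\cdots c_{i_m}c_j}{C,\alpha}\big\rangle\in\mathbb{P}(C,\alpha,\gamma)$ for all $j$. The map $\Gamma^\alpha_n:\mathbf{H}\to\mathbf{H}$ is $\Gamma^\alpha_n(T)=T_2$ where $T_0=T\big[\tfrac{\mu_1}{\alpha}\mapsto\tfrac{\mu_1}{\mu_{n+1}},\ldots,\tfrac{\mu_n}{\alpha}\mapsto\tfrac{\mu_n}{\mu_{2n}}\big]$, $T_1=T_0[1\mapsto0,\mu_1\mapsto0,\ldots,\mu_n\mapsto0]$, $T_2=T_1[\mu_{n+1}\mapsto\mu_1,\ldots,\mu_{2n}\mapsto\mu_n]$. Finally $W\in\mathbb{P}_2(C,\alpha,\gamma)$ iff there are $W_1,\ldots,W_k\in\mathbf{H}$ with $W=\langle\alpha,W_k,W_{k-1},\ldots,W_1\rangle$, $W_k\in\tau_\gamma(\{\mu_1,\ldots,\mu_n\}^+)$, $W_{i+1}=W_i[\langle\mu_1,0\rangle\mapsto\mu_1,\ldots,\langle\mu_n,0\rangle\mapsto\mu_n]$ for all $i\in\{1,\ldots,k-1\}$, and $W_1=\Gamma^\alpha_n(T)$ for some $T\in\mathbb{P}(C,\alpha,\gamma)$.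 -}

module Defs where

open import Data.Nat using (ℕ; zero; suc; _+_; _≤_)
open import Data.Bool using (Bool; true; false)
open import Data.Fin using (Fin; _↑ˡ_; _↑ʳ_)
open import Data.List using (List; []; _∷_; _++_; map; concatMap; allFin)
open import Data.List.NonEmpty using (List⁺; _∷_)
open import Data.Product using (_×_; _,_; Σ; Σ-syntax)
open import Relation.Nullary using (¬_; Dec; yes; no)
open import Relation.Binary.PropositionalEquality using (_≡_; refl; cong₂)

data H : Set where
  ⊥ : H
  ⟨_,_⟩ : H → H → H

_≟H_ : (s t : H) → Dec (s ≡ t)
⊥ ≟H ⊥ = yes refl
⊥ ≟H ⟨ _ , _ ⟩ = no λ ()
⟨ _ , _ ⟩ ≟H ⊥ = no λ ()
⟨ a , b ⟩ ≟H ⟨ c , d ⟩ with a ≟H c | b ≟H d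
... | yes refl | yes refl = yes refl
... | no p | _ = no λ { refl → p refl }
... | yes _ | no q = no λ { refl → q refl }

data _⊑_ : H → H → Set where
  here  : ∀ {t} → t ⊑ t
  left  : ∀ {s a b} → s ⊑ a → s ⊑ ⟨ a , b ⟩
  right : ∀ {s a b} → s ⊑ b → s ⊑ ⟨ a , b ⟩

Incomparable : H → H → Set
Incomparable s t = (¬ s ⊑ t) × (¬ t ⊑ s)

_[_↦_] : H → H → H → H
t [ r ↦ s ] with t ≟H r
... | yes _ = s
t [ r ↦ s ] | no _ with t
... | ⊥ = ⊥
... | ⟨ a , b ⟩ = ⟨ a [ r ↦ s ] , b [ r ↦ s ] ⟩

replaceSeq : H → List (H × H) → H
replaceSeq t [] = t
replaceSeq t ((r , s) ∷ ps) = replaceSeq (t [ r ↦ s ]) ps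

-- left-nested tuples: tup x (y₁ ∷ … ∷ yₖ ∷ []) = ⟨ x , yₖ , … , y₁ ⟩
tup : H → List H → H
tup x [] = x
tup x (y ∷ ys) = ⟨ tup x ys , y ⟩

-- ⊥^k  (only meaningful for k ≥ 1; ⊥^ 0 is set to ⊥ as junk)
⊥^ : ℕ → H
⊥^ zero = ⊥
⊥^ (suc zero) = ⊥
⊥^ (suc (suc k)) = ⟨ ⊥^ (suc k) , ⊥ ⟩

g : ℕ → H
g i = ⟨ ⊥^ (3 + i) , ⊥^ (3 + i) ⟩

-- The alphabet {0, 1, μ₁, …, μ₂ₙ}; μ (k) stands for μ_{k+1}
data Letter (n : ℕ) : Set where
  𝟘 𝟙 : Letter n
  μ : Fin (n + n) → Letter n

-- τ_α(w) = w / α, for words over letters identified with trees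
τ : H → List H → H
τ α [] = α
τ α (a ∷ w) = ⟨ α , a ⟩ [ α ↦ τ α w ]

initL : {A : Set} → A → List A → List A
initL x [] = []
initL x (y ∷ ys) = x ∷ initL y ys

initNE : {A : Set} → List⁺ A → List A
initNE (x ∷ xs) = initL x xs

-- Constructions, relative to an assignment `code` of letters to indices i
-- (letter a is identified with tree g (code a)) and a sequence C of
-- nonempty binary strings c₁,…,cₙ (indexed by Fin n).

module Constructions {n : ℕ} (code : Letter n → ℕ) where

  ⟦_⟧ : Letter n → H
  ⟦ a ⟧ = g (code a)

  zeroT oneT : H
  zeroT = ⟦ 𝟘 ⟧
  oneT = ⟦ 𝟙 ⟧

  bit : Bool → H
  bit false = zeroT
  bit true = oneT

  -- μ_i for i ∈ {1,…,n}  (μlo k = μ_{k+1})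
  μlo : Fin n → H
  μlo k = ⟦ μ (k ↑ˡ n) ⟧

  -- μ_{n+i} for i ∈ {1,…,n}  (μhi k = μ_{n+k+1})
  μhi : Fin n → H
  μhi k = ⟦ μ (n ↑ʳ k) ⟧

  InTauMu : H → H → Set
  InTauMu γ X = Σ[ u ∈ List⁺ (Fin n) ] X ≡ τ γ (map μlo (Data.List.NonEmpty.toList u))

  Γ : H → H → H
  Γ α T = T₂
    where
    T₀ = replaceSeq T (map (λ k → τ α (μlo k ∷ []) , τ (μhi k) (μlo k ∷ [])) (allFin n))
    T₁ = replaceSeq T₀ ((oneT , zeroT) ∷ map (λ k → μlo k , zeroT) (allFin n))
    T₂ = replaceSeq T₁ (map (λ k → μhi k , μlo k) (allFin n))

  strip : H → H
  strip W = replaceSeq W (map (λ k → ⟨ μlo k , zeroT ⟩ , μlo k) (allFin n))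

  module WithC (C : Fin n → List⁺ Bool) (α γ : H) where

    -- c_{i₁} ⋯ c_{iₘ} / (C , α) = τ_α(w_{i₁} μ_{i₁} ⋯ w_{iₘ} μ_{iₘ}) where c_i = w_i d
    encC : List (Fin n) → H
    encC is = τ α (concatMap (λ i → map bit (initNE (C i)) ++ (μlo i ∷ [])) is)

    data ℙ : H → Set where
      base : ∀ i → ℙ ⟨ γ , encC (i ∷ []) ⟩
      step : ∀ {T} (R : H) (i : Fin n) (is : List (Fin n)) (j : Fin n) →
             ℙ T → T ≡ ⟨ R , encC (i ∷ is) ⟩ →
             ℙ ⟨ T , encC ((i ∷ is) ++ (j ∷ [])) ⟩

    -- membership in ℙ₂(C, α, γ); Ws zero, …, Ws (fromℕ k) are W₁, …, W_{k+1}
    ℙ₂ : H → Set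
    ℙ₂ W = Σ[ k ∈ ℕ ] Σ[ Ws ∈ (Fin (suc k) → H) ]
             (W ≡ tup α (Data.List.tabulate Ws))
           × InTauMu γ (Ws (Data.Fin.fromℕ k))
           × (∀ (i : Fin k) → Ws (Data.Fin.suc i) ≡ strip (Ws (Data.Fin.inject₁ i)))
           × (Σ[ T ∈ H ] ℙ T × (Ws Data.Fin.zero ≡ Γ α T))

-- In a tree T ∈ ℙ(C,α,γ) every occurrence of α is the left child of a node ⟨α, μᵢ⟩: the
-- encodings are built with τ_α from letters incomparable with α, and γ avoids α. The first
-- stage of Γ^α_n replaces exactly these nodes by α-free trees and the later stages only
-- insert letters, so W₁ = Γ^α_n(T) is α-free. Hence replacing ⟨α, Wₖ⟩ by α and stripping
-- turns ⟨α, Wₖ, …, W₁⟩ into ⟨α, Wₖ, …, W₂⟩, which gives W = ⟨V, W₁⟩; conversely this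
-- equation, applied to V = ⟨V′, W₂⟩ with W₂ = strip W₁ and so on, unrolls W into such a tuple.
module Submission where

open import Defs
open import Data.Nat using (ℕ; zero; suc; _+_; _≤_; s≤s)
open import Data.Nat.Properties using (≤-refl; ≤-trans; m≤m+n; m≤n+m; n≤1+n; <⇒≱)
open import Data.Bool using (Bool; true; false)
open import Data.Empty renaming (⊥ to Empty) using (⊥-elim)
open import Data.Fin using (Fin; fromℕ; inject₁) renaming (zero to fzero; suc to fsuc)
open import Data.List using (List; []; _∷_; _++_; map; concatMap; allFin; tabulate)
open import Data.List.Properties using (∷-injectiveˡ; ++-identityʳ; map-cong)
open import Data.List.Membership.Propositional.Properties using (∈-allFin)
open import Data.List.NonEmpty using (List⁺)
open import Data.List.Relation.Unary.All as All using (All; []; _∷_)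
open import Data.List.Relation.Unary.All.Properties using (map⁺; ++⁺)
open import Data.Product using (_×_; _,_; proj₁; proj₂; Σ-syntax)
open import Data.Sum using (_⊎_; inj₁; inj₂)
open import Function using (_∘_)
open import Function.Bundles using (_⇔_; mk⇔)
open import Function.Definitions using (Injective)
open import Relation.Binary.PropositionalEquality
open import Relation.Nullary using (¬_; yes; no)

size : H → ℕ
size ⊥ = 1
size ⟨ a , b ⟩ = suc (size a + size b)

⊑-trans : ∀ {s t u} → s ⊑ t → t ⊑ u → s ⊑ u
⊑-trans p here = p
⊑-trans p (left q) = left (⊑-trans p q)
⊑-trans p (right q) = right (⊑-trans p q)

⊑-pairˡ : ∀ {a b x} → ⟨ a , b ⟩ ⊑ x → a ⊑ x
⊑-pairˡ = ⊑-trans (left here)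

⊑-size : ∀ {s t} → s ⊑ t → size s ≤ size t
⊑-size here = ≤-refl
⊑-size {t = ⟨ a , b ⟩} (left p) = ≤-trans (⊑-size p) (≤-trans (m≤m+n (size a) (size b)) (n≤1+n _))
⊑-size {t = ⟨ a , b ⟩} (right p) = ≤-trans (⊑-size p) (≤-trans (m≤n+m (size b) (size a)) (n≤1+n _))

pair⋢left : ∀ {a b} → ¬ ⟨ a , b ⟩ ⊑ a
pair⋢left {a} {b} p = <⇒≱ (s≤s (m≤m+n (size a) (size b))) (⊑-size p)

pair-injective : ∀ {a b c d} → ⟨ a , b ⟩ ≡ ⟨ c , d ⟩ → a ≡ c × b ≡ d
pair-injective refl = refl , refl

pair≢ : ∀ {a b x y} → y ⊑ a → ¬ y ⊑ x → ⟨ a , b ⟩ ≢ x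
pair≢ {y = y} y⊑a y⋢x e = y⋢x (subst (y ⊑_) e (left y⊑a))

⊑ˡ⇒pair≢ : ∀ {a b x} → x ⊑ a → ⟨ a , b ⟩ ≢ x
⊑ˡ⇒pair≢ {a} x⊑a e = pair⋢left (subst (_⊑ a) (sym e) x⊑a)

pair-avoids : ∀ {x a b} → ¬ x ⊑ a → ¬ x ⊑ b → ⟨ a , b ⟩ ≢ x → ¬ x ⊑ ⟨ a , b ⟩
pair-avoids _ _ pair≢x here = pair≢x refl
pair-avoids x⋢a _ _ (left p) = x⋢a p
pair-avoids _ x⋢b _ (right p) = x⋢b p

[↦]-self : ∀ t s → t [ t ↦ s ] ≡ s
[↦]-self t s with t ≟H t
... | yes _ = refl
... | no t≢t = ⊥-elim (t≢t refl)

[↦]-node : ∀ {a b r} s → ⟨ a , b ⟩ ≢ r → ⟨ a , b ⟩ [ r ↦ s ] ≡ ⟨ a [ r ↦ s ] , b [ r ↦ s ] ⟩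
[↦]-node {a} {b} {r} s pair≢r with ⟨ a , b ⟩ ≟H r
... | yes pair≡r = ⊥-elim (pair≢r pair≡r)
... | no _ = refl

[↦]-fresh : ∀ t {r} s → ¬ r ⊑ t → t [ r ↦ s ] ≡ t
[↦]-fresh t {r} s r⋢t with t ≟H r
... | yes refl = ⊥-elim (r⋢t here)
[↦]-fresh ⊥ s _ | no _ = refl
[↦]-fresh ⟨ a , b ⟩ s r⋢t | no _ =
  cong₂ ⟨_,_⟩ ([↦]-fresh a s (r⋢t ∘ left)) ([↦]-fresh b s (r⋢t ∘ right))

[↦]-id : ∀ t r → t [ r ↦ r ] ≡ t
[↦]-id t r with t ≟H r
... | yes t≡r = sym t≡r
[↦]-id ⊥ r | no _ = refl
[↦]-id ⟨ a , b ⟩ r | no _ = cong₂ ⟨_,_⟩ ([↦]-id a r) ([↦]-id b r)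

[↦]-unchanged-or-contains : ∀ t r s → t [ r ↦ s ] ≡ t ⊎ s ⊑ (t [ r ↦ s ])
[↦]-unchanged-or-contains t r s with t ≟H r
... | yes _ = inj₂ here
[↦]-unchanged-or-contains ⊥ r s | no _ = inj₁ refl
[↦]-unchanged-or-contains ⟨ a , b ⟩ r s | no _
  with [↦]-unchanged-or-contains a r s | [↦]-unchanged-or-contains b r s
... | inj₁ a′≡a | inj₁ b′≡b = inj₁ (cong₂ ⟨_,_⟩ a′≡a b′≡b)
... | inj₂ s⊑a′ | _ = inj₂ (left s⊑a′)
... | inj₁ _ | inj₂ s⊑b′ = inj₂ (right s⊑b′)

[↦]-pair≢ : ∀ {a b x} r s → ⟨ a , b ⟩ ≢ x → ¬ s ⊑ x → ⟨ a [ r ↦ s ] , b [ r ↦ s ] ⟩ ≢ x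
[↦]-pair≢ {a} {b} r s pair≢x s⋢x e
  with [↦]-unchanged-or-contains a r s | [↦]-unchanged-or-contains b r s
... | inj₁ a′≡a | inj₁ b′≡b = pair≢x (trans (cong₂ ⟨_,_⟩ (sym a′≡a) (sym b′≡b)) e)
... | inj₂ s⊑a′ | _ = s⋢x (subst (s ⊑_) e (left s⊑a′))
... | inj₁ _ | inj₂ s⊑b′ = s⋢x (subst (s ⊑_) e (right s⊑b′))

[↦]-avoids : ∀ {x} t r s → ¬ x ⊑ t → ¬ x ⊑ s → ¬ s ⊑ x → ¬ x ⊑ (t [ r ↦ s ])
[↦]-avoids t r s _ _ _ with t ≟H r
[↦]-avoids t r s _ x⋢s _ | yes _ = x⋢s
[↦]-avoids ⊥ r s x⋢t _ _ | no _ = x⋢t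
[↦]-avoids ⟨ a , b ⟩ r s x⋢t x⋢s s⋢x | no _ =
  pair-avoids ([↦]-avoids a r s (x⋢t ∘ left) x⋢s s⋢x)
              ([↦]-avoids b r s (x⋢t ∘ right) x⋢s s⋢x)
              ([↦]-pair≢ {a} {b} r s (λ { refl → x⋢t here }) s⋢x)

[↦]-keeps : ∀ {x t r} s → x ⊑ t → ¬ x ⊑ r → ¬ r ⊑ x → x ⊑ (t [ r ↦ s ])
[↦]-keeps {t = t} s here _ r⋢t = subst (t ⊑_) (sym ([↦]-fresh t s r⋢t)) here
[↦]-keeps {t = ⟨ a , b ⟩} {r} s (left p) x⋢r r⋢x with ⟨ a , b ⟩ ≟H r
... | yes refl = ⊥-elim (x⋢r (left p))
... | no _ = left ([↦]-keeps s p x⋢r r⋢x)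
[↦]-keeps {t = ⟨ a , b ⟩} {r} s (right p) x⋢r r⋢x with ⟨ a , b ⟩ ≟H r
... | yes refl = ⊥-elim (x⋢r (right p))
... | no _ = right ([↦]-keeps s p x⋢r r⋢x)

replaceSeq-fresh : ∀ t ps → All (λ p → ¬ proj₁ p ⊑ t) ps → replaceSeq t ps ≡ t
replaceSeq-fresh t [] [] = refl
replaceSeq-fresh t ((r , s) ∷ ps) (r⋢t ∷ h) rewrite [↦]-fresh t s r⋢t = replaceSeq-fresh t ps h

replaceSeq-avoids : ∀ {x} t ps → ¬ x ⊑ t → All (λ p → ¬ x ⊑ proj₂ p × ¬ proj₂ p ⊑ x) ps →
                    ¬ x ⊑ replaceSeq t ps
replaceSeq-avoids t [] x⋢t [] = x⋢t
replaceSeq-avoids t ((r , s) ∷ ps) x⋢t ((x⋢s , s⋢x) ∷ h) =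
  replaceSeq-avoids (t [ r ↦ s ]) ps ([↦]-avoids t r s x⋢t x⋢s s⋢x) h

replaceSeq-node : ∀ {x a} b ps → x ⊑ a → All (λ p → ¬ x ⊑ proj₁ p × ¬ proj₁ p ⊑ x) ps →
                  replaceSeq ⟨ a , b ⟩ ps ≡ ⟨ replaceSeq a ps , replaceSeq b ps ⟩
replaceSeq-node b [] _ [] = refl
replaceSeq-node {x} {a} b ((r , s) ∷ ps) x⊑a ((x⋢r , r⋢x) ∷ h) =
  trans (cong (λ t → replaceSeq t ps) ([↦]-node {a} {b} s (pair≢ x⊑a x⋢r)))
        (replaceSeq-node (b [ r ↦ s ]) ps ([↦]-keeps s x⊑a x⋢r r⋢x) h)

τ-singleton : ∀ β a → τ β (a ∷ []) ≡ ⟨ β , a ⟩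
τ-singleton β a = [↦]-id ⟨ β , a ⟩ β

τ-∷ : ∀ β a w → ¬ β ⊑ a → τ β (a ∷ w) ≡ ⟨ τ β w , a ⟩
τ-∷ β a w β⋢a =
  trans ([↦]-node {β} {a} (τ β w) (⊑ˡ⇒pair≢ here))
        (cong₂ ⟨_,_⟩ ([↦]-self β (τ β w)) ([↦]-fresh a (τ β w) β⋢a))

module Guarding (α : H) where

  data Guarded (P : H → Set) : H → Set where
    avoiding : ∀ {t} → ¬ α ⊑ t → Guarded P t
    guard : ∀ {x} → ¬ α ⊑ x → P x → Guarded P ⟨ α , x ⟩
    node : ∀ {a b} → ⟨ a , b ⟩ ≢ α → Guarded P a → Guarded P b → Guarded P ⟨ a , b ⟩

  Guarded-map : ∀ {P Q : H → Set} {t} → (∀ {x} → P x → Q x) → Guarded P t → Guarded Q t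
  Guarded-map f (avoiding α⋢t) = avoiding α⋢t
  Guarded-map f (guard α⋢x px) = guard α⋢x (f px)
  Guarded-map f (node ne ga gb) = node ne (Guarded-map f ga) (Guarded-map f gb)

  Guarded-avoids : ∀ {P : H → Set} {t} → (∀ {x} → ¬ P x) → Guarded P t → ¬ α ⊑ t
  Guarded-avoids ¬P (avoiding α⋢t) = α⋢t
  Guarded-avoids ¬P (guard _ px) = ⊥-elim (¬P px)
  Guarded-avoids ¬P (node ne ga gb) = pair-avoids (Guarded-avoids ¬P ga) (Guarded-avoids ¬P gb) ne

  Guarded-[↦] : ∀ {P t x₀ s} → ¬ α ⊑ s → ¬ s ⊑ α → Guarded P t →
                Guarded (λ x → P x × x ≢ x₀) (t [ ⟨ α , x₀ ⟩ ↦ s ])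
  Guarded-[↦] {t = t} {x₀} {s} α⋢s s⋢α (avoiding α⋢t) = avoiding ([↦]-avoids t ⟨ α , x₀ ⟩ s α⋢t α⋢s s⋢α)
  Guarded-[↦] {x₀ = x₀} {s} α⋢s _ (guard {x} α⋢x px) with ⟨ α , x ⟩ ≟H ⟨ α , x₀ ⟩
  ... | yes _ = avoiding α⋢s
  ... | no ne =
    subst (Guarded _) (sym (cong₂ ⟨_,_⟩ ([↦]-fresh α s pair⋢left) ([↦]-fresh x s (α⋢x ∘ ⊑-pairˡ))))
      (guard α⋢x (px , λ { refl → ne refl }))
  Guarded-[↦] {x₀ = x₀} {s} α⋢s s⋢α (node {a} {b} ne ga gb) with ⟨ a , b ⟩ ≟H ⟨ α , x₀ ⟩
  ... | yes _ = avoiding α⋢s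
  ... | no _ = node ([↦]-pair≢ _ s ne s⋢α) (Guarded-[↦] α⋢s s⋢α ga) (Guarded-[↦] α⋢s s⋢α gb)

  Guarded-replaceSeq : ∀ {I : Set} {P t} (x s : I → H) → (∀ i → ¬ α ⊑ s i × ¬ s i ⊑ α) →
    ∀ is → Guarded P t →
    Guarded (λ y → P y × All (λ i → y ≢ x i) is) (replaceSeq t (map (λ i → ⟨ α , x i ⟩ , s i) is))
  Guarded-replaceSeq x s s-ok [] g = Guarded-map (_, []) g
  Guarded-replaceSeq x s s-ok (i ∷ is) g =
    Guarded-map (λ { ((py , y≢xi) , y≢xs) → py , y≢xi ∷ y≢xs })
      (Guarded-replaceSeq x s s-ok is (Guarded-[↦] (proj₁ (s-ok i)) (proj₂ (s-ok i)) g))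

  data GuardedWord (P : H → Set) : List H → Set where
    last : ∀ {a} → ¬ α ⊑ a → P a → GuardedWord P (a ∷ [])
    _∷_ : ∀ {a w} → ¬ α ⊑ a → GuardedWord P w → GuardedWord P (a ∷ w)

  GuardedWord-++ : ∀ {P u w} → All (λ a → ¬ α ⊑ a) u → GuardedWord P w → GuardedWord P (u ++ w)
  GuardedWord-++ [] gw = gw
  GuardedWord-++ (α⋢a ∷ h) gw = α⋢a ∷ GuardedWord-++ h gw

  ⊑-τ : ∀ {P w} → GuardedWord P w → α ⊑ τ α w
  ⊑-τ (last {a} _ _) = subst (α ⊑_) (sym (τ-singleton α a)) (left here)
  ⊑-τ (_∷_ {a} {w} α⋢a gw) = subst (α ⊑_) (sym (τ-∷ α a w α⋢a)) (left (⊑-τ gw))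

  Guarded-τ : ∀ {P w} → GuardedWord P w → Guarded P (τ α w)
  Guarded-τ {P} (last {a} α⋢a pa) = subst (Guarded P) (sym (τ-singleton α a)) (guard α⋢a pa)
  Guarded-τ {P} (_∷_ {a} {w} α⋢a gw) =
    subst (Guarded P) (sym (τ-∷ α a w α⋢a)) (node (⊑ˡ⇒pair≢ (⊑-τ gw)) (Guarded-τ gw) (avoiding α⋢a))

module Peeling (α : H) (f : H → H) (f-α : f α ≡ α) (f-avoids : ∀ {t} → ¬ α ⊑ t → ¬ α ⊑ f t)
               (f-node : ∀ {a} b → α ⊑ a → f ⟨ a , b ⟩ ≡ ⟨ f a , f b ⟩) where

  peel : H → H → H
  peel X W = f (W [ ⟨ α , X ⟩ ↦ α ])

  data Chain (X : H) : H → List H → Set where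
    done : Chain X X []
    next : ∀ {y z zs} → z ≡ f y → Chain X z zs → Chain X y (z ∷ zs)

  Chain-⊑ : ∀ {X y ys} → Chain X y ys → ⟨ α , X ⟩ ⊑ tup α (y ∷ ys)
  Chain-⊑ done = here
  Chain-⊑ (next _ ch) = left (Chain-⊑ ch)

  peel-pair : ∀ {X U y} → ¬ α ⊑ y → ⟨ α , X ⟩ ⊑ U → peel X ⟨ U , y ⟩ ≡ ⟨ peel X U , f y ⟩
  peel-pair {X} {U} {y} α⋢y r⊑U =
    begin
      f (⟨ U , y ⟩ [ r ↦ α ])
    ≡⟨ cong f ([↦]-node α (⊑ˡ⇒pair≢ r⊑U)) ⟩
      f ⟨ U [ r ↦ α ] , y [ r ↦ α ] ⟩
    ≡⟨ cong (λ y′ → f ⟨ U [ r ↦ α ] , y′ ⟩) ([↦]-fresh y α (α⋢y ∘ ⊑-pairˡ)) ⟩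
      f ⟨ U [ r ↦ α ] , y ⟩
    ≡⟨ f-node y α⊑U′ ⟩
      ⟨ peel X U , f y ⟩
    ∎
    where
    open ≡-Reasoning
    r = ⟨ α , X ⟩
    α⊑U′ : α ⊑ (U [ r ↦ α ])
    α⊑U′ with [↦]-unchanged-or-contains U r α
    ... | inj₁ U′≡U = subst (α ⊑_) (sym U′≡U) (⊑-pairˡ r⊑U)
    ... | inj₂ α⊑U′ = α⊑U′

  peel-tup : ∀ {X y ys} → ¬ α ⊑ y → Chain X y ys → peel X (tup α (y ∷ ys)) ≡ tup α ys
  peel-tup {X} _ done = trans (cong f ([↦]-self ⟨ α , X ⟩ α)) f-α
  peel-tup {X} {y} α⋢y (next {z = z} {zs} z≡fy ch) =
    begin
      peel X ⟨ tup α (z ∷ zs) , y ⟩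
    ≡⟨ peel-pair α⋢y (Chain-⊑ ch) ⟩
      ⟨ peel X (tup α (z ∷ zs)) , f y ⟩
    ≡⟨ cong₂ ⟨_,_⟩ (peel-tup (subst (¬_ ∘ (α ⊑_)) (sym z≡fy) (f-avoids α⋢y)) ch) (sym z≡fy) ⟩
      ⟨ tup α zs , z ⟩
    ∎
    where open ≡-Reasoning

  unroll-peel : ∀ {X} U {y} → ¬ α ⊑ y → ⟨ α , X ⟩ ⊑ ⟨ U , y ⟩ → U ≡ peel X ⟨ U , y ⟩ →
                Σ[ ys ∈ List H ] U ≡ tup α ys × Chain X y ys
  unroll-peel U α⋢y here _ = [] , refl , done
  unroll-peel U α⋢y (right r⊑y) _ = ⊥-elim (α⋢y (⊑-pairˡ r⊑y))
  unroll-peel ⟨ U′ , z ⟩ α⋢y (left r⊑U) U≡ with pair-injective (trans U≡ (peel-pair α⋢y r⊑U))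
  ... | U′≡ , z≡fy with unroll-peel U′ (subst (¬_ ∘ (α ⊑_)) (sym z≡fy) (f-avoids α⋢y)) r⊑U U′≡
  ... | ys , U′≡tup , ch = z ∷ ys , cong₂ ⟨_,_⟩ U′≡tup refl , next z≡fy ch

  Steps : ∀ k → (Fin (suc k) → H) → Set
  Steps k Ws = ∀ (i : Fin k) → Ws (fsuc i) ≡ f (Ws (inject₁ i))

  steps⇒chain : ∀ k Ws → Steps k Ws → Chain (Ws (fromℕ k)) (Ws fzero) (tabulate (Ws ∘ fsuc))
  steps⇒chain zero Ws _ = done
  steps⇒chain (suc k) Ws st = next (st fzero) (steps⇒chain k (Ws ∘ fsuc) (st ∘ fsuc))

  chain⇒steps : ∀ {X y ys} → Chain X y ys →
    Σ[ k ∈ ℕ ] Σ[ Ws ∈ (Fin (suc k) → H) ] tabulate Ws ≡ y ∷ ys × Ws (fromℕ k) ≡ X × Steps k Ws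
  chain⇒steps {X} done = zero , (λ _ → X) , refl , refl , λ ()
  chain⇒steps {y = y} (next z≡fy ch) with chain⇒steps ch
  ... | k , Ws , Ws≡ , last≡ , st =
    suc k , (λ { fzero → y ; (fsuc i) → Ws i }) , cong (y ∷_) Ws≡ , last≡ ,
    λ { fzero → trans (∷-injectiveˡ Ws≡) z≡fy ; (fsuc i) → st i }

  steps⇒peel : ∀ {k Ws W} → W ≡ tup α (tabulate Ws) → Steps k Ws → ¬ α ⊑ Ws fzero →
               ⟨ α , Ws (fromℕ k) ⟩ ⊑ W × W ≡ ⟨ peel (Ws (fromℕ k)) W , Ws fzero ⟩
  steps⇒peel {k} {Ws} refl st α⋢W₁ =
    Chain-⊑ ch , cong (⟨_, Ws fzero ⟩) (sym (peel-tup α⋢W₁ ch))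
    where ch = steps⇒chain k Ws st

  peel⇒steps : ∀ {X W y} → ¬ α ⊑ y → ⟨ α , X ⟩ ⊑ W → W ≡ ⟨ peel X W , y ⟩ →
    Σ[ k ∈ ℕ ] Σ[ Ws ∈ (Fin (suc k) → H) ]
      W ≡ tup α (tabulate Ws) × Ws (fromℕ k) ≡ X × Steps k Ws × Ws fzero ≡ y
  peel⇒steps {X} {W} {y} α⋢y r⊑W W≡
    with unroll-peel (peel X W) α⋢y (subst (⟨ α , X ⟩ ⊑_) W≡ r⊑W) (cong (peel X) W≡)
  ... | ys , V≡tup , ch with chain⇒steps ch
  ... | k , Ws , Ws≡ , last≡ , st =
    k , Ws , trans W≡ (trans (cong (⟨_, y ⟩) V≡tup) (cong (tup α) (sym Ws≡))) , last≡ , st ,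
    ∷-injectiveˡ Ws≡

module Encoding {n : ℕ} (code : Letter n → ℕ) (code-pos : ∀ a → 1 ≤ code a)
                (C : Fin n → List⁺ Bool) (α γ : H) (α∥γ : Incomparable α γ)
                (α∥g : ∀ i → 1 ≤ i → Incomparable α (g i)) where
  open Constructions code
  open WithC C α γ
  open Guarding α

  α⋢letter : ∀ a → ¬ α ⊑ ⟦ a ⟧
  α⋢letter a = proj₁ (α∥g (code a) (code-pos a))

  letter⋢α : ∀ a → ¬ ⟦ a ⟧ ⊑ α
  letter⋢α a = proj₂ (α∥g (code a) (code-pos a))

  letter-incomparable : ∀ a → ¬ α ⊑ ⟦ a ⟧ × ¬ ⟦ a ⟧ ⊑ α
  letter-incomparable a = α⋢letter a , letter⋢α a

  α⋢letter-pair : ∀ a b → ¬ α ⊑ ⟨ ⟦ a ⟧ , ⟦ b ⟧ ⟩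
  α⋢letter-pair a b = pair-avoids (α⋢letter a) (α⋢letter b) (pair≢ here (letter⋢α a))

  strip-α : strip α ≡ α
  strip-α = replaceSeq-fresh α _ (map⁺ (All.universal (λ k → letter⋢α _ ∘ ⊑-pairˡ) (allFin n)))

  strip-avoids : ∀ {t} → ¬ α ⊑ t → ¬ α ⊑ strip t
  strip-avoids {t} α⋢t =
    replaceSeq-avoids t _ α⋢t (map⁺ (All.universal (λ k → letter-incomparable _) (allFin n)))

  strip-node : ∀ {a} b → α ⊑ a → strip ⟨ a , b ⟩ ≡ ⟨ strip a , strip b ⟩
  strip-node b α⊑a = replaceSeq-node b _ α⊑a
    (map⁺ (All.universal (λ k → α⋢letter-pair _ 𝟘 , letter⋢α _ ∘ ⊑-pairˡ) (allFin n)))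

  open Peeling α strip strip-α strip-avoids strip-node public

  IsMu : H → Set
  IsMu x = Σ[ i ∈ Fin n ] x ≡ μlo i

  encC-guarded : ∀ i is → Guarded IsMu (encC (i ∷ is))
  encC-guarded i is = Guarded-τ (word i is)
    where
    block : Fin n → List H
    block i = map bit (initNE (C i)) ++ (μlo i ∷ [])

    bits-avoid : ∀ i → All (λ a → ¬ α ⊑ a) (map bit (initNE (C i)))
    bits-avoid i = map⁺ (All.universal (λ { false → α⋢letter 𝟘 ; true → α⋢letter 𝟙 }) _)

    word : ∀ i is → GuardedWord IsMu (concatMap block (i ∷ is))
    word i [] = subst (GuardedWord IsMu) (sym (++-identityʳ (block i)))
                      (GuardedWord-++ (bits-avoid i) (last (α⋢letter _) (i , refl)))
    word i (j ∷ js) = GuardedWord-++ (++⁺ (bits-avoid i) (α⋢letter _ ∷ [])) (word j js)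

  ℙ-⊒γ : ∀ {T} → ℙ T → γ ⊑ T
  ℙ-⊒γ (base _) = left here
  ℙ-⊒γ (step _ _ _ _ p _) = left (ℙ-⊒γ p)

  ℙ-guarded : ∀ {T} → ℙ T → Guarded IsMu T
  ℙ-guarded (base i) = node (pair≢ here (proj₂ α∥γ)) (avoiding (proj₁ α∥γ)) (encC-guarded i [])
  ℙ-guarded (step _ i is j p _) =
    node (pair≢ (ℙ-⊒γ p) (proj₂ α∥γ)) (ℙ-guarded p) (encC-guarded i (is ++ j ∷ []))

  Γ-avoids : ∀ {T} → ℙ T → ¬ α ⊑ Γ α T
  Γ-avoids {T} p =
    replaceSeq-avoids _ _
      (replaceSeq-avoids _ _ α⋢T₀
        (letter-incomparable 𝟘 ∷ map⁺ (All.universal (λ _ → letter-incomparable 𝟘) (allFin n))))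
      (map⁺ (All.universal (λ _ → letter-incomparable _) (allFin n)))
    where
    T₀-pairs≡ : map (λ k → τ α (μlo k ∷ []) , τ (μhi k) (μlo k ∷ [])) (allFin n)
              ≡ map (λ k → ⟨ α , μlo k ⟩ , ⟨ μhi k , μlo k ⟩) (allFin n)
    T₀-pairs≡ = map-cong (λ k → cong₂ _,_ (τ-singleton α _) (τ-singleton (μhi k) _)) (allFin n)

    α⋢T₀ : ¬ α ⊑ replaceSeq T (map (λ k → τ α (μlo k ∷ []) , τ (μhi k) (μlo k ∷ [])) (allFin n))
    α⋢T₀ rewrite T₀-pairs≡ =
      Guarded-avoids (λ { ((i , refl) , μ≢) → All.lookup μ≢ (∈-allFin i) refl })
        (Guarded-replaceSeq μlo (λ k → ⟨ μhi k , μlo k ⟩)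
          (λ k → α⋢letter-pair _ _ , letter⋢α _ ∘ ⊑-pairˡ) (allFin n) (ℙ-guarded p))

  PeelsTo : H → Set
  PeelsTo W = Σ[ X ∈ H ] InTauMu γ X × ⟨ α , X ⟩ ⊑ W × Σ[ T ∈ H ] ℙ T × W ≡ ⟨ peel X W , Γ α T ⟩

  ℙ₂⇒PeelsTo : ∀ W → ℙ₂ W → PeelsTo W
  ℙ₂⇒PeelsTo W (k , Ws , W≡ , X∈ , st , T , pT , W₁≡ΓT) with
    steps⇒peel {k} {Ws} W≡ st (subst (¬_ ∘ (α ⊑_)) (sym W₁≡ΓT) (Γ-avoids pT))
  ... | r⊑W , W≡⟨V,W₁⟩ = Ws (fromℕ k) , X∈ , r⊑W , T , pT , trans W≡⟨V,W₁⟩ (cong ⟨ _ ,_⟩ W₁≡ΓT)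

  PeelsTo⇒ℙ₂ : ∀ W → PeelsTo W → ℙ₂ W
  PeelsTo⇒ℙ₂ W (X , X∈ , r⊑W , T , pT , W≡) with peel⇒steps (Γ-avoids pT) r⊑W W≡
  ... | k , Ws , W≡tup , last≡X , st , W₁≡ΓT =
    k , Ws , W≡tup , subst (InTauMu γ) (sym last≡X) X∈ , st , T , pT , W₁≡ΓT

lemma5 : (n : ℕ) (code : Letter n → ℕ) → Injective _≡_ _≡_ code → (∀ a → 1 ≤ code a) →
    (C : Fin n → List⁺ Bool) (α γ : H) →
    Incomparable α γ →
    (∀ i → 1 ≤ i → Incomparable α (g i)) →
    (∀ (i : Fin n) → ¬ (γ ⊑ Constructions.μlo code i)) →
    (W : H) →
    Constructions.WithC.ℙ₂ code C α γ W ⇔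
      (Σ[ X ∈ H ] (Constructions.InTauMu code γ X × (⟨ α , X ⟩ ⊑ W)
        × (Σ[ T ∈ H ] Constructions.WithC.ℙ code C α γ T
          × (W ≡ ⟨ replaceSeq W ((⟨ α , X ⟩ , α) ∷ map (λ k → ⟨ Constructions.μlo code k , Constructions.zeroT code ⟩ , Constructions.μlo code k) (allFin n))
                 , Constructions.Γ code α T ⟩))))
lemma5 n code _ code-pos C α γ α∥γ α∥g _ W =
  mk⇔ (ℙ₂⇒PeelsTo W) (PeelsTo⇒ℙ₂ W)
  where open Encoding code code-pos C α γ α∥γ α∥g
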